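{- Let $\delta$ be any even positive integer. Then there are infinitely many odd positive integers $n$ for which there exist positive divisors $d_1, d_2>1$ of $\frac{n^2+1}{2}$ such that $$d_1+d_2=\delta(n+1)+2 .$$
   Context: This is the section result for the linear polynomial $\delta n+\varepsilon$ with $\varepsilon=\delta+2$. -}

module Defs where

open import Data.Nat using (ℕ; _+_; _*_; _<_; _≤_)
open import Data.Nat.DivMod using (_/_)
open import Data.Nat.Divisibility using (_∣_)
open import Relation.Nullary using (¬_)
open import Data.Product using (∃-syntax; _×_)
open import Relation.Binary.PropositionalEquality using (_≡_)

-- (n^2 + 1) / 2  (exact when n is odd)
half : ℕ → ℕ
half n = (n * n + 1) / 2

Good : ℕ → ℕ → Set
Good δ n = ∃[ d₁ ] ∃[ d₂ ] (1 < d₁ × 1 < d₂ × d₁ ∣ half n × d₂ ∣ half n × d₁ + d₂ ≡ δ * (n + 1) + 2)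

Even : ℕ → Set
Even m = 2 ∣ m

Odd : ℕ → Set
Odd m = ¬ (2 ∣ m)

module Submission where

-- Idea of the proof (Vieta jumping).  The construction works for every
-- δ ≥ 2, which is all that evenness and positivity of δ are used for.
-- Call (n , x , y) a solution when
--     x + y ≡ δ(n+1) + 2    and    n² + 1 ≡ 2xy,
-- so that x and y are complementary divisors of (n²+1)/2 with the
-- required sum.  For fixed y the second equation, after eliminating x by
-- the first, is a quadratic  n² − 2δy·n + … = 0  in n; its second root
-- n' = 2δy − n gives a new solution (n' , y , y') with
-- y' = δ(n'+1) + 2 − y.  Starting from the seed solution
-- (2δ+1 , 1 , 2δ² + 2δ + 1) and jumping repeatedly, n strictly increases
-- (as long as n ≤ y, which the jump preserves), so solutions with
-- arbitrarily large n exist.  One final jump makes both divisors exceed 1,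
-- and any solution gives an odd n with (n²+1)/2 = xy.

open import Defs
open import Data.List using (_∷_; [])
open import Data.Nat using (ℕ; zero; suc; _+_; _*_; _≤_; _<_; z≤n; s≤s; z<s; >-nonZero)
open import Data.Nat.Properties
open import Data.Nat.DivMod using (_/_; m*n/n≡m)
open import Data.Nat.Divisibility using (_∣_; divides; ∣-trans; m∣m*n; n∣m*n; ∣m+n∣m⇒∣n; ∣1⇒≡1; ∣⇒≤)
open import Data.Nat.Tactic.RingSolver using (solve)
open import Data.Product using (∃-syntax; _×_; _,_)
open import Relation.Binary.PropositionalEquality using (_≡_; refl; sym; trans; cong; subst; module ≡-Reasoning)

record Solution (δ n x y : ℕ) : Set where
  constructor solution
  field
    sum≡  : x + y ≡ δ * (n + 1) + 2
    prod≡ : n * n + 1 ≡ 2 * (x * y)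

-- The two roots n, n' of  t² − A·t + c  satisfy  n'² + A·n = n² + A·n'
-- (both sides equal  n² + n·n' + n'²  once A = n + n').
vietaSwap : ∀ {n n' A} → n + n' ≡ A → n' * n' + A * n ≡ n * n + A * n'
vietaSwap {n} {n'} refl = solve (n ∷ n' ∷ [])

-- Both sides of the product equation, increased by
-- T = 2y² + 2δy·n, equal 2y(δ(n+1)+2) + 2δy·n'.
jumpSolution : ∀ {δ n x y n' y'} → Solution δ n x y →
               n + n' ≡ 2 * δ * y → y + y' ≡ δ * (n' + 1) + 2 →
               Solution δ n' y y'
jumpSolution {δ} {n} {x} {y} {n'} {y'} (solution sum≡ prod≡) roots≡ next≡ =
  solution next≡ (+-cancelʳ-≡ (2 * (y * y) + 2 * δ * y * n) (n' * n' + 1) (2 * (y * y')) (begin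
    n' * n' + 1 + (2 * (y * y) + 2 * δ * y * n)  ≡⟨ solve (n ∷ n' ∷ y ∷ δ ∷ []) ⟩
    (n' * n' + 2 * δ * y * n) + (1 + 2 * (y * y))  ≡⟨ cong (_+ (1 + 2 * (y * y))) (vietaSwap roots≡) ⟩
    (n * n + 2 * δ * y * n') + (1 + 2 * (y * y))   ≡⟨ solve (n ∷ n' ∷ y ∷ δ ∷ []) ⟩
    (n * n + 1) + 2 * (y * y) + 2 * δ * y * n'     ≡⟨ cong (λ m → m + 2 * (y * y) + 2 * δ * y * n') prod≡ ⟩
    2 * (x * y) + 2 * (y * y) + 2 * δ * y * n'     ≡⟨ solve (x ∷ n' ∷ y ∷ δ ∷ []) ⟩
    2 * y * (x + y) + 2 * δ * y * n'               ≡⟨ cong (λ m → 2 * y * m + 2 * δ * y * n') sum≡ ⟩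
    2 * y * (δ * (n + 1) + 2) + 2 * δ * y * n'     ≡⟨ solve (n ∷ n' ∷ y ∷ δ ∷ []) ⟩
    2 * y * (δ * (n' + 1) + 2) + 2 * δ * y * n     ≡⟨ cong (λ m → 2 * y * m + 2 * δ * y * n) (sym next≡) ⟩
    2 * y * (y + y') + 2 * δ * y * n               ≡⟨ solve (n ∷ y' ∷ y ∷ δ ∷ []) ⟩
    2 * (y * y') + (2 * (y * y) + 2 * δ * y * n)  ∎))
  where open ≡-Reasoning

otherRoot : ∀ {δ n y} → 2 ≤ δ → n ≤ y → ∃[ n' ] (n + n' ≡ 2 * δ * y × 3 * y ≤ n')
otherRoot {δ} {n} {y} 2≤δ n≤y =
  let n' , roots≡ = m≤n⇒∃[o]m+o≡n (≤-trans n≤y (≤-trans (m≤m+n y (3 * y)) 4y≤2δy))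
  in  n' , roots≡ , +-cancelˡ-≤ n _ _ (begin
        n + 3 * y   ≤⟨ +-monoˡ-≤ (3 * y) n≤y ⟩
        4 * y       ≤⟨ 4y≤2δy ⟩
        2 * δ * y   ≡⟨ sym roots≡ ⟩
        n + n'      ∎)
  where
  open ≤-Reasoning
  4y≤2δy : 4 * y ≤ 2 * δ * y
  4y≤2δy = *-monoˡ-≤ y (*-monoʳ-≤ 2 2≤δ)

cofactor : ∀ {δ y n'} → 2 ≤ δ → y ≤ n' → ∃[ y' ] (y + y' ≡ δ * (n' + 1) + 2 × n' ≤ y')
cofactor {δ} {y} {n'} 2≤δ y≤n' =
  let y' , next≡ = m≤n⇒∃[o]m+o≡n (≤-trans y≤n' (≤-trans (m≤m+n n' _) 2n'≤δ[n'+1]+2))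
  in  y' , next≡ , +-cancelˡ-≤ y _ _ (begin
        y + n'            ≤⟨ +-monoˡ-≤ n' y≤n' ⟩
        n' + n'           ≡⟨ cong (n' +_) (sym (+-identityʳ n')) ⟩
        2 * n'            ≤⟨ 2n'≤δ[n'+1]+2 ⟩
        δ * (n' + 1) + 2  ≡⟨ sym next≡ ⟩
        y + y'            ∎)
  where
  open ≤-Reasoning
  2n'≤δ[n'+1]+2 : 2 * n' ≤ δ * (n' + 1) + 2
  2n'≤δ[n'+1]+2 = begin
    2 * n'            ≤⟨ *-monoˡ-≤ n' 2≤δ ⟩
    δ * n'            ≤⟨ *-monoʳ-≤ δ (m≤m+n n' 1) ⟩
    δ * (n' + 1)      ≤⟨ m≤m+n _ 2 ⟩
    δ * (n' + 1) + 2  ∎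

-- One jump stays inside ℕ, strictly increases n and preserves n ≤ y.
-- Here δ ≥ 2 is essential: for δ = 1 the jumps cycle.
jump : ∀ {δ n x y} → 2 ≤ δ → Solution δ n x y → 1 < n → n ≤ y →
       ∃[ n' ] ∃[ y' ] (Solution δ n' y y' × n < n' × n' ≤ y')
jump {y = y} 2≤δ sol 1<n n≤y =
  let n' , roots≡ , 3y≤n' = otherRoot 2≤δ n≤y
      -- y ≥ n > 1, so y < y + 2y = 3y ≤ n'
      0<2y = <-≤-trans (<-≤-trans z<s 1<n) (≤-trans n≤y (m≤m+n y _))
      y<n' = <-≤-trans (m<m+n y 0<2y) 3y≤n'
      y' , next≡ , n'≤y' = cofactor 2≤δ (<⇒≤ y<n')
  in  n' , y' , jumpSolution sol roots≡ next≡ , ≤-<-trans n≤y y<n' , n'≤y'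

solutionsBeyond : ∀ {δ} → 2 ≤ δ → ∀ N →
                  ∃[ n ] ∃[ x ] ∃[ y ] (Solution δ n x y × N ≤ n × 1 < n × n ≤ y)
solutionsBeyond {δ} 2≤δ zero =
  1 + 2 * δ , 1 , 2 * δ * δ + (1 + 2 * δ) ,
  solution (solve (δ ∷ [])) (solve (δ ∷ [])) , z≤n , s≤s 1≤2δ , m≤n+m _ _
  where
  1≤2δ : 1 ≤ 2 * δ
  1≤2δ = ≤-trans (≤-trans (s≤s z≤n) 2≤δ) (m≤m+n δ _)
solutionsBeyond 2≤δ (suc N) with solutionsBeyond 2≤δ N
... | n , x , y , sol , N≤n , 1<n , n≤y with jump 2≤δ sol 1<n n≤y
...   | n' , y' , sol' , n<n' , n'≤y' =
  n' , y , y' , sol' , ≤-trans (s≤s N≤n) n<n' , <-trans 1<n n<n' , n'≤y'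

half≡ : ∀ n m → n * n + 1 ≡ 2 * m → half n ≡ m
half≡ n m eq = trans (cong (_/ 2) (trans eq (*-comm 2 m))) (m*n/n≡m m 2)

-- n² + 1 even forces n odd (otherwise 2 would divide 1).
odd-if-square+1-even : ∀ n m → n * n + 1 ≡ 2 * m → Odd n
odd-if-square+1-even n m eq 2∣n
  with ∣1⇒≡1 (∣m+n∣m⇒∣n (divides m (trans eq (*-comm 2 m))) (∣-trans 2∣n (m∣m*n n)))
... | ()

solution⇒Good : ∀ {δ n x y} → Solution δ n x y → 1 < x → 1 < y → Good δ n
solution⇒Good {n = n} {x} {y} (solution sum≡ prod≡) 1<x 1<y =
  x , y , 1<x , 1<y ,
  subst (x ∣_) (sym (half≡ n (x * y) prod≡)) (m∣m*n y) ,
  subst (y ∣_) (sym (half≡ n (x * y) prod≡)) (n∣m*n x) ,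
  sum≡

-- The theorem for every δ ≥ 2: take a solution with n ≥ N and jump once
-- more; the shared factor y ≥ n and the new factor y' ≥ n' both exceed 1.
goodOddBeyond : ∀ {δ} → 2 ≤ δ → (N : ℕ) → ∃[ n ] (N ≤ n × Odd n × 0 < n × Good δ n)
goodOddBeyond 2≤δ N with solutionsBeyond 2≤δ N
... | n , x , y , sol , N≤n , 1<n , n≤y with jump 2≤δ sol 1<n n≤y
...   | n' , y' , sol' , n<n' , n'≤y' =
  n' , ≤-trans N≤n (<⇒≤ n<n') , odd-if-square+1-even n' (y * y') (Solution.prod≡ sol') ,
  <-trans z<s 1<n' , solution⇒Good sol' (<-≤-trans 1<n n≤y) (<-≤-trans 1<n' n'≤y')
  where
  1<n' : 1 < n'
  1<n' = <-trans 1<n n<n'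

-- Evenness is used only to get δ ≥ 2: a positive multiple of 2 is ≥ 2.
mainTheorem1 : (δ : ℕ) → Even δ → 0 < δ → (N : ℕ) → ∃[ n ] (N ≤ n × Odd n × 0 < n × Good δ n)
mainTheorem1 δ 2∣δ 0<δ = goodOddBeyond (∣⇒≤ {{>-nonZero 0<δ}} 2∣δ)
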